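{- Let $F\in\mathbb{Z}[X_1,\ldots,X_n]^n$ be an invertible polynomial map of the form $F_i=X_i+H_i$, where $H_i$ has degree $D_i$ and lower degree $d_i\ge 2$; put $d=\min_i d_i$, $D=\max_i D_i$, and let $G\in\mathbb{Z}[X]^n$ be its inverse. Let $p$ be a prime such that $\overline{F}^p$ (the reduction of $F$ modulo $p$) is invertible over $\mathbb{F}_p$, with inverse $U=(U_1,\ldots,U_n)$. Let $P_0=X$, $P_{l+1}=P_l\circ F-P_l$, $V_0=X$, $V_{l+1}=V_l\circ\overline{F}^p-V_l$, and for $m\ge1$ put $R^i_m=\sum_{j=0}^{m-1}(-1)^jP^i_j-G_i$ and $W^i_m=\sum_{j=0}^{m-1}(-1)^jV^i_j-U_i$. Then for every $i=1,\ldots,n$: (a) $U_i=\overline{G_i}^p$; (b) for every integer $m>\frac{D^{n-1}-d_i}{d-1}+1$ we have $W^i_m=\overline{R^i_m}^p$.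
   Context: The lower degree of a polynomial is the minimal total degree of a monomial appearing in it with nonzero coefficient. $\overline{T}^p$ denotes reduction of the coefficients of $T$ modulo $p$. Superscript $i$ denotes the $i$-th component. -}

module Defs where

open import Data.Nat as ℕ using (ℕ; zero; suc)
open import Data.Integer as ℤ using (ℤ; +_; -_)
open import Data.Integer.Divisibility using () renaming (_∣_ to _∣ℤ_)
open import Data.Fin using (Fin; zero; suc)
open import Data.Vec using (Vec; []; _∷_; zipWith; replicate; lookup; tabulate)
open import Data.Vec.Properties using (≡-dec)
open import Data.List using (List; []; _∷_; _++_; map; concatMap)
open import Data.Product using (_×_; _,_; ∃)
open import Data.Bool using (if_then_else_)
open import Relation.Nullary using (¬_; does)
open import Relation.Binary.PropositionalEquality using (_≡_)

-- Multivariate polynomials in n variables X_1..X_n (indexed by Fin n)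
-- with integer coefficients, as finite lists of terms (c , α), meaning
-- the sum of c·X^α.  A polynomial is determined by its coefficient
-- function `coeff`; equality of polynomials is equality of coefficients.

Monomial : ℕ → Set
Monomial n = Vec ℕ n

Poly : ℕ → Set
Poly n = List (ℤ × Monomial n)

coeff : ∀ {n} → Poly n → Monomial n → ℤ
coeff [] α = + 0
coeff ((c , β) ∷ f) α =
  if does (≡-dec ℕ._≟_ β α) then c ℤ.+ coeff f α else coeff f α

totDeg : ∀ {n} → Monomial n → ℕ
totDeg [] = 0
totDeg (k ∷ α) = k ℕ.+ totDeg α

0P : ∀ {n} → Poly n
0P = []

constP : ∀ {n} → ℤ → Poly n
constP {n} c = (c , replicate n 0) ∷ []

1P : ∀ {n} → Poly n
1P = constP (+ 1)

varP : ∀ {n} → Fin n → Poly n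
varP {n} i = (+ 1 , tabulate (λ j → if does (i Data.Fin.≟ j) then 1 else 0)) ∷ []

infixl 6 _+P_ _-P_
infixl 7 _*P_

_+P_ : ∀ {n} → Poly n → Poly n → Poly n
f +P g = f ++ g

negP : ∀ {n} → Poly n → Poly n
negP = map (λ { (c , α) → (- c , α) })

_-P_ : ∀ {n} → Poly n → Poly n → Poly n
f -P g = f +P negP g

_*P_ : ∀ {n} → Poly n → Poly n → Poly n
f *P g = concatMap (λ { (c , α) → map (λ { (e , β) → (c ℤ.* e , zipWith ℕ._+_ α β) }) g }) f

powP : ∀ {n} → Poly n → ℕ → Poly n
powP f zero = 1P
powP f (suc k) = f *P powP f k

monoSubst : ∀ {n m} → Monomial n → (Fin n → Poly m) → Poly m
monoSubst [] g = 1P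
monoSubst (k ∷ α) g = powP (g zero) k *P monoSubst α (λ j → g (suc j))

substP : ∀ {n m} → Poly n → (Fin n → Poly m) → Poly m
substP [] g = 0P
substP ((c , α) ∷ f) g = (constP c *P monoSubst α g) +P substP f g

PolyMap : ℕ → Set
PolyMap n = Fin n → Poly n

idMap : ∀ {n} → PolyMap n
idMap = varP

_∘P_ : ∀ {n} → PolyMap n → PolyMap n → PolyMap n
(A ∘P B) i = substP (A i) B

-- Equality in ℤ[X] and in 𝔽_p[X].
-- 𝔽_p[X_1..X_n] is modelled as ℤ[X_1..X_n] modulo p: two integer
-- polynomials represent the same element of 𝔽_p[X] iff all their
-- coefficients are congruent mod p.  The ring operations on
-- representatives are those of ℤ[X] (reduction mod p is a ring
-- homomorphism compatible with substitution).

_≈ℤ_ : ∀ {n} → Poly n → Poly n → Set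
f ≈ℤ g = ∀ α → coeff f α ≡ coeff g α

_≡ℤ[_]_ : ℤ → ℕ → ℤ → Set
a ≡ℤ[ p ] b = (+ p) ∣ℤ (a ℤ.- b)

_≈[_]_ : ∀ {n} → Poly n → ℕ → Poly n → Set
f ≈[ p ] g = ∀ α → coeff f α ≡ℤ[ p ] coeff g α

-- reduction of coefficients modulo p: ℤ[X] → 𝔽_p[X]
-- (identity on representatives, in the above model of 𝔽_p[X])
reduce : ∀ {n} → ℕ → Poly n → Poly n
reduce p f = f

reduceMap : ∀ {n} → ℕ → PolyMap n → PolyMap n
reduceMap p F i = reduce p (F i)

IsInverseℤ : ∀ {n} → PolyMap n → PolyMap n → Set
IsInverseℤ F G = (∀ i → (F ∘P G) i ≈ℤ idMap i) × (∀ i → (G ∘P F) i ≈ℤ idMap i)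

IsInverse[_] : ∀ {n} → ℕ → PolyMap n → PolyMap n → Set
IsInverse[ p ] F G = (∀ i → (F ∘P G) i ≈[ p ] idMap i) × (∀ i → (G ∘P F) i ≈[ p ] idMap i)

InvertibleOver𝔽 : ∀ {n} → ℕ → PolyMap n → Set
InvertibleOver𝔽 p F = ∃ λ U → IsInverse[ p ] F U

HasDegree : ∀ {n} → Poly n → ℕ → Set
HasDegree h D =
  (∃ λ α → ¬ coeff h α ≡ + 0 × totDeg α ≡ D) ×
  (∀ α → ¬ coeff h α ≡ + 0 → totDeg α ℕ.≤ D)

HasLowerDegree : ∀ {n} → Poly n → ℕ → Set
HasLowerDegree h d =
  (∃ λ α → ¬ coeff h α ≡ + 0 × totDeg α ≡ d) ×
  (∀ α → ¬ coeff h α ≡ + 0 → d ℕ.≤ totDeg α)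

IsMin : ∀ {n} → (Fin n → ℕ) → ℕ → Set
IsMin f d = (∃ λ i → f i ≡ d) × (∀ i → d ℕ.≤ f i)

IsMax : ∀ {n} → (Fin n → ℕ) → ℕ → Set
IsMax f D = (∃ λ i → f i ≡ D) × (∀ i → f i ℕ.≤ D)

-- the sequences P_l (over ℤ, with F) resp. V_l (over 𝔽_p, with F̄^p):
-- Q_0 = X, Q_{l+1} = Q_l ∘ F − Q_l

iterDiff : ∀ {n} → PolyMap n → ℕ → PolyMap n
iterDiff F zero = idMap
iterDiff F (suc l) i = (iterDiff F l ∘P F) i -P iterDiff F l i

minusOnePow : ℕ → ℤ
minusOnePow zero = + 1
minusOnePow (suc j) = - minusOnePow j

altSum : ∀ {n} → (ℕ → PolyMap n) → ℕ → Fin n → Poly n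
altSum Q zero i = 0P
altSum Q (suc m) i = altSum Q m i +P (constP (minusOnePow m) *P Q m i)

module Submission where

-- Idea: over 𝔽_p a left inverse U and a right inverse G of F must agree, since
-- U = U∘X = U∘(F∘G) = (U∘F)∘G = X∘G = G.  The inverse G over ℤ is in particular a
-- right inverse of F modulo p, which gives (a).  In Defs reduction mod p is the
-- identity on representatives, so V_l = P_l and W_m − R_m = G − U; thus (b) is
-- (a) after subtracting from the same alternating sum, for every m.

open import Defs
open import Data.Nat using (ℕ; _≥_; _∸_; _^_)
open import Data.Integer using (+_; _-_; _*_; _<_)
open import Data.Nat.Primality using (Prime)
open import Data.Fin using (Fin)
open import Data.Product using (_×_)

open import Data.Nat using (zero; suc)
import Data.Nat as ℕ
import Data.Nat.Properties as ℕP
open import Data.Integer using (ℤ; _+_; -_)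
import Data.Integer.Properties as ℤP
open import Data.Integer.Divisibility.Signed
  using (divides; ∣ᵤ⇒∣; ∣⇒∣ᵤ; ∣m∣n⇒∣m+n; ∣m⇒∣-m; ∣n⇒∣m*n; ∣m⇒∣m*n)
  renaming (_∣_ to _∣ˢ_)
open import Data.Integer.Tactic.RingSolver using (solve-∀)
open import Data.Fin using (zero; suc)
open import Data.Vec using ([]; _∷_; zipWith; replicate; tabulate)
open import Data.Vec.Properties using (≡-dec; zipWith-comm; zipWith-assoc; zipWith-identityˡ)
open import Data.List using ([]; _∷_; _++_; map; length)
open import Data.Product using (_,_)
open import Data.Bool using (if_then_else_; true; false)
open import Relation.Nullary using (¬_; does; yes; no)
open import Relation.Binary.PropositionalEquality
  using (_≡_; refl; sym; trans; cong; cong₂; module ≡-Reasoning)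
open import Data.Empty using (⊥-elim)

open ≡-Reasoning

-- Congruence of integers modulo p.  Defs states it as divisibility of a - b,
-- `a ≡ℤ[ p ] b`; we wrap that in a record so that a and b stay inferable, and show
-- it is a ring congruence.
infix 4 _≡_[mod_]
record _≡_[mod_] (a b : ℤ) (p : ℕ) : Set where
  constructor from-≡ℤ[]
  field to-≡ℤ[] : a ≡ℤ[ p ] b
open _≡_[mod_]

module _ {p : ℕ} where

  private
    divides-difference : ∀ {a b e} → e ≡ a - b → + p ∣ˢ e → a ≡ b [mod p ]
    divides-difference refl p∣e = from-≡ℤ[] (∣⇒∣ᵤ p∣e)

    divides-of : ∀ {a b} → a ≡ b [mod p ] → + p ∣ˢ (a - b)
    divides-of {a} {b} (from-≡ℤ[] p∣a-b) = ∣ᵤ⇒∣ {+ p} {a - b} p∣a-b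

  ≡⇒mod : ∀ {a b} → a ≡ b → a ≡ b [mod p ]
  ≡⇒mod {a} refl = divides-difference (sym (ℤP.+-inverseʳ a)) (divides (+ 0) refl)

  mod-sym : ∀ {a b} → a ≡ b [mod p ] → b ≡ a [mod p ]
  mod-sym {a} {b} a≡b = divides-difference (identity a b) (∣m⇒∣-m (divides-of a≡b))
    where identity : ∀ a b → - (a - b) ≡ b - a
          identity = solve-∀

  mod-trans : ∀ {a b c} → a ≡ b [mod p ] → b ≡ c [mod p ] → a ≡ c [mod p ]
  mod-trans {a} {b} {c} a≡b b≡c =
    divides-difference (identity a b c) (∣m∣n⇒∣m+n (divides-of a≡b) (divides-of b≡c))
    where identity : ∀ a b c → (a - b) + (b - c) ≡ a - c
          identity = solve-∀

  +-cong-mod : ∀ {a b c d} → a ≡ b [mod p ] → c ≡ d [mod p ] → a + c ≡ b + d [mod p ]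
  +-cong-mod {a} {b} {c} {d} a≡b c≡d =
    divides-difference (identity a b c d) (∣m∣n⇒∣m+n (divides-of a≡b) (divides-of c≡d))
    where identity : ∀ a b c d → (a - b) + (c - d) ≡ (a + c) - (b + d)
          identity = solve-∀

  *-cong-mod : ∀ {a b c d} → a ≡ b [mod p ] → c ≡ d [mod p ] → a * c ≡ b * d [mod p ]
  *-cong-mod {a} {b} {c} {d} a≡b c≡d = divides-difference (identity a b c d)
    (∣m∣n⇒∣m+n (∣n⇒∣m*n a (divides-of c≡d)) (∣m⇒∣m*n d (divides-of a≡b)))
    where identity : ∀ a b c d → a * (c - d) + (a - b) * d ≡ a * c - b * d
          identity = solve-∀

  mod⇒difference : ∀ {a b} → a ≡ b [mod p ] → a - b ≡ + 0 [mod p ]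
  mod⇒difference {a} {b} a≡b = divides-difference (sym (ℤP.+-identityʳ (a - b))) (divides-of a≡b)

  difference⇒mod : ∀ {a b} → a - b ≡ + 0 [mod p ] → a ≡ b [mod p ]
  difference⇒mod {a} {b} a-b≡0 = divides-difference (ℤP.+-identityʳ (a - b)) (divides-of a-b≡0)

  neg-cong-mod : ∀ {a b} → a ≡ b [mod p ] → - a ≡ - b [mod p ]
  neg-cong-mod {a} {b} a≡b = divides-difference (identity a b) (∣m⇒∣-m (divides-of a≡b))
    where identity : ∀ a b → - (a - b) ≡ - a - - b
          identity = solve-∀

infixl 6 _⊕_
_⊕_ : ∀ {n} → Monomial n → Monomial n → Monomial n
_⊕_ = zipWith ℕ._+_

0ᵐ : ∀ n → Monomial n
0ᵐ n = replicate n 0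

⊕-comm : ∀ {n} (β γ : Monomial n) → β ⊕ γ ≡ γ ⊕ β
⊕-comm = zipWith-comm ℕP.+-comm

⊕-assoc : ∀ {n} (β γ η : Monomial n) → (β ⊕ γ) ⊕ η ≡ β ⊕ (γ ⊕ η)
⊕-assoc = zipWith-assoc ℕP.+-assoc

⊕-identityˡ : ∀ {n} (β : Monomial n) → 0ᵐ n ⊕ β ≡ β
⊕-identityˡ = zipWith-identityˡ ℕP.+-identityˡ

⊕-identityʳ : ∀ {n} (β : Monomial n) → β ⊕ 0ᵐ n ≡ β
⊕-identityʳ β = trans (⊕-comm β _) (⊕-identityˡ β)

-- It is invariant under reordering and merging of terms, so it sees f as an honest
-- polynomial; products and substitutions get the closed pairing formulas below.
⟦_⟧ : ∀ {n} → Poly n → (Monomial n → ℤ) → ℤ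
⟦ [] ⟧ φ = + 0
⟦ (c , β) ∷ f ⟧ φ = c * φ β + ⟦ f ⟧ φ

⟦⟧-++ : ∀ {n} (f g : Poly n) φ → ⟦ f ++ g ⟧ φ ≡ ⟦ f ⟧ φ + ⟦ g ⟧ φ
⟦⟧-++ [] g φ = sym (ℤP.+-identityˡ _)
⟦⟧-++ ((c , β) ∷ f) g φ =
  trans (cong (λ z → c * φ β + z) (⟦⟧-++ f g φ)) (sym (ℤP.+-assoc (c * φ β) _ _))

⟦⟧-negP : ∀ {n} (f : Poly n) φ → ⟦ negP f ⟧ φ ≡ - ⟦ f ⟧ φ
⟦⟧-negP [] φ = refl
⟦⟧-negP ((c , β) ∷ f) φ = begin
  - c * φ β + ⟦ negP f ⟧ φ  ≡⟨ cong₂ _+_ (sym (ℤP.neg-distribˡ-* c (φ β))) (⟦⟧-negP f φ) ⟩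
  - (c * φ β) + - ⟦ f ⟧ φ   ≡⟨ sym (ℤP.neg-distrib-+ (c * φ β) (⟦ f ⟧ φ)) ⟩
  - (c * φ β + ⟦ f ⟧ φ)     ∎

⟦⟧--P : ∀ {n} (f g : Poly n) φ → ⟦ f -P g ⟧ φ ≡ ⟦ f ⟧ φ - ⟦ g ⟧ φ
⟦⟧--P f g φ = trans (⟦⟧-++ f (negP g) φ) (cong (λ z → ⟦ f ⟧ φ + z) (⟦⟧-negP g φ))

⟦⟧-cong : ∀ {n} (f : Poly n) {φ ψ} → (∀ β → φ β ≡ ψ β) → ⟦ f ⟧ φ ≡ ⟦ f ⟧ ψ
⟦⟧-cong [] φ≗ψ = refl
⟦⟧-cong ((c , β) ∷ f) φ≗ψ = cong₂ (λ x y → c * x + y) (φ≗ψ β) (⟦⟧-cong f φ≗ψ)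

⟦⟧-zero : ∀ {n} (f : Poly n) → ⟦ f ⟧ (λ _ → + 0) ≡ + 0
⟦⟧-zero [] = refl
⟦⟧-zero ((c , β) ∷ f) = cong₂ _+_ (ℤP.*-zeroʳ c) (⟦⟧-zero f)

⟦⟧-+ : ∀ {n} (f : Poly n) φ ψ → ⟦ f ⟧ (λ β → φ β + ψ β) ≡ ⟦ f ⟧ φ + ⟦ f ⟧ ψ
⟦⟧-+ [] φ ψ = refl
⟦⟧-+ ((c , β) ∷ f) φ ψ =
  trans (cong (λ z → c * (φ β + ψ β) + z) (⟦⟧-+ f φ ψ)) (identity c (φ β) (ψ β) (⟦ f ⟧ φ) (⟦ f ⟧ ψ))
  where identity : ∀ c x y u v → c * (x + y) + (u + v) ≡ (c * x + u) + (c * y + v)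
        identity = solve-∀

⟦⟧-scale : ∀ {n} (f : Poly n) a φ → ⟦ f ⟧ (λ β → a * φ β) ≡ a * ⟦ f ⟧ φ
⟦⟧-scale [] a φ = sym (ℤP.*-zeroʳ a)
⟦⟧-scale ((c , β) ∷ f) a φ =
  trans (cong (λ z → c * (a * φ β) + z) (⟦⟧-scale f a φ)) (identity c a (φ β) (⟦ f ⟧ φ))
  where identity : ∀ c a x u → c * (a * x) + a * u ≡ a * (c * x + u)
        identity = solve-∀

⟦⟧-swap : ∀ {n m} (f : Poly n) (g : Poly m) (ψ : Monomial n → Monomial m → ℤ) →
  ⟦ f ⟧ (λ β → ⟦ g ⟧ (ψ β)) ≡ ⟦ g ⟧ (λ γ → ⟦ f ⟧ (λ β → ψ β γ))
⟦⟧-swap [] g ψ = sym (⟦⟧-zero g)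
⟦⟧-swap ((c , β) ∷ f) g ψ = begin
  c * ⟦ g ⟧ (ψ β) + ⟦ f ⟧ (λ β → ⟦ g ⟧ (ψ β))
    ≡⟨ cong₂ _+_ (sym (⟦⟧-scale g c (ψ β))) (⟦⟧-swap f g ψ) ⟩
  ⟦ g ⟧ (λ γ → c * ψ β γ) + ⟦ g ⟧ (λ γ → ⟦ f ⟧ (λ β → ψ β γ))
    ≡⟨ sym (⟦⟧-+ g _ _) ⟩
  ⟦ g ⟧ (λ γ → c * ψ β γ + ⟦ f ⟧ (λ β → ψ β γ)) ∎

-- Multiplying g by a single term c·X^β; by definition of _*P_,
-- ((c , β) ∷ f) *P g  is  term*P c β g ++ f *P g.
term*P : ∀ {n} → ℤ → Monomial n → Poly n → Poly n
term*P c β = map (λ { (e , γ) → (c * e , β ⊕ γ) })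

⟦⟧-term*P : ∀ {n} c β (g : Poly n) φ → ⟦ term*P c β g ⟧ φ ≡ c * ⟦ g ⟧ (λ γ → φ (β ⊕ γ))
⟦⟧-term*P c β [] φ = sym (ℤP.*-zeroʳ c)
⟦⟧-term*P c β ((e , γ) ∷ g) φ =
  trans (cong (λ z → (c * e) * φ (β ⊕ γ) + z) (⟦⟧-term*P c β g φ))
        (identity c e (φ (β ⊕ γ)) (⟦ g ⟧ (λ γ → φ (β ⊕ γ))))
  where identity : ∀ c e x u → (c * e) * x + c * u ≡ c * (e * x + u)
        identity = solve-∀

⟦⟧-* : ∀ {n} (f g : Poly n) φ → ⟦ f *P g ⟧ φ ≡ ⟦ f ⟧ (λ β → ⟦ g ⟧ (λ γ → φ (β ⊕ γ)))
⟦⟧-* [] g φ = refl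
⟦⟧-* ((c , β) ∷ f) g φ = begin
  ⟦ term*P c β g ++ f *P g ⟧ φ
    ≡⟨ ⟦⟧-++ (term*P c β g) (f *P g) φ ⟩
  ⟦ term*P c β g ⟧ φ + ⟦ f *P g ⟧ φ
    ≡⟨ cong₂ _+_ (⟦⟧-term*P c β g φ) (⟦⟧-* f g φ) ⟩
  c * ⟦ g ⟧ (λ γ → φ (β ⊕ γ)) + ⟦ f ⟧ (λ β → ⟦ g ⟧ (λ γ → φ (β ⊕ γ))) ∎

⟦⟧-1P : ∀ {n} φ → ⟦ 1P {n} ⟧ φ ≡ φ (0ᵐ n)
⟦⟧-1P φ = trans (ℤP.+-identityʳ _) (ℤP.*-identityˡ _)

⟦⟧-constP* : ∀ {n} c (h : Poly n) φ → ⟦ constP c *P h ⟧ φ ≡ c * ⟦ h ⟧ φ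
⟦⟧-constP* c h φ =
  trans (⟦⟧-* (constP c) h φ)
        (trans (ℤP.+-identityʳ _) (cong (c *_) (⟦⟧-cong h (λ γ → cong φ (⊕-identityˡ γ)))))

⟦⟧-substP : ∀ {n m} (f : Poly n) (B : Fin n → Poly m) φ →
  ⟦ substP f B ⟧ φ ≡ ⟦ f ⟧ (λ β → ⟦ monoSubst β B ⟧ φ)
⟦⟧-substP [] B φ = refl
⟦⟧-substP ((c , α) ∷ f) B φ =
  trans (⟦⟧-++ (constP c *P monoSubst α B) (substP f B) φ)
        (cong₂ _+_ (⟦⟧-constP* c (monoSubst α B) φ) (⟦⟧-substP f B φ))

-- f ≐ g: f and g pair equally with every functional, i.e. they are the same
-- polynomial.  The identities of polynomial algebra are proved in this form.
infix 4 _≐_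
record _≐_ {n} (f g : Poly n) : Set where
  constructor pairs-equally
  field pairing : ∀ φ → ⟦ f ⟧ φ ≡ ⟦ g ⟧ φ
open _≐_

≐-refl : ∀ {n} {f : Poly n} → f ≐ f
≐-refl = pairs-equally λ φ → refl

≐-sym : ∀ {n} {f g : Poly n} → f ≐ g → g ≐ f
≐-sym f≐g = pairs-equally λ φ → sym (pairing f≐g φ)

≐-trans : ∀ {n} {f g h : Poly n} → f ≐ g → g ≐ h → f ≐ h
≐-trans f≐g g≐h = pairs-equally λ φ → trans (pairing f≐g φ) (pairing g≐h φ)

*-cong : ∀ {n} {f f' g g' : Poly n} → f ≐ f' → g ≐ g' → f *P g ≐ f' *P g'
*-cong {f = f} {f'} {g} {g'} f≐f' g≐g' = pairs-equally λ φ → begin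
  ⟦ f *P g ⟧ φ                                    ≡⟨ ⟦⟧-* f g φ ⟩
  ⟦ f ⟧ (λ β → ⟦ g ⟧ (λ γ → φ (β ⊕ γ)))           ≡⟨ ⟦⟧-cong f (λ β → pairing g≐g' _) ⟩
  ⟦ f ⟧ (λ β → ⟦ g' ⟧ (λ γ → φ (β ⊕ γ)))          ≡⟨ pairing f≐f' _ ⟩
  ⟦ f' ⟧ (λ β → ⟦ g' ⟧ (λ γ → φ (β ⊕ γ)))         ≡⟨ sym (⟦⟧-* f' g' φ) ⟩
  ⟦ f' *P g' ⟧ φ                                  ∎

*-identityˡ : ∀ {n} (f : Poly n) → 1P *P f ≐ f
*-identityˡ f = pairs-equally λ φ →
  trans (⟦⟧-* 1P f φ) (trans (⟦⟧-1P (λ β → ⟦ f ⟧ (λ γ → φ (β ⊕ γ)))) (⟦⟧-cong f (λ β → cong φ (⊕-identityˡ β))))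

*-identityʳ : ∀ {n} (f : Poly n) → f *P 1P ≐ f
*-identityʳ f = pairs-equally λ φ →
  trans (⟦⟧-* f 1P φ) (⟦⟧-cong f (λ β → trans (⟦⟧-1P (λ γ → φ (β ⊕ γ))) (cong φ (⊕-identityʳ β))))

*-comm : ∀ {n} (f g : Poly n) → f *P g ≐ g *P f
*-comm f g = pairs-equally λ φ → begin
  ⟦ f *P g ⟧ φ                             ≡⟨ ⟦⟧-* f g φ ⟩
  ⟦ f ⟧ (λ β → ⟦ g ⟧ (λ γ → φ (β ⊕ γ)))    ≡⟨ ⟦⟧-swap f g _ ⟩
  ⟦ g ⟧ (λ γ → ⟦ f ⟧ (λ β → φ (β ⊕ γ)))    ≡⟨ ⟦⟧-cong g (λ γ → ⟦⟧-cong f (λ β → cong φ (⊕-comm β γ))) ⟩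
  ⟦ g ⟧ (λ γ → ⟦ f ⟧ (λ β → φ (γ ⊕ β)))    ≡⟨ sym (⟦⟧-* g f φ) ⟩
  ⟦ g *P f ⟧ φ                             ∎

*-assoc : ∀ {n} (f g h : Poly n) → (f *P g) *P h ≐ f *P (g *P h)
*-assoc f g h = pairs-equally λ φ → begin
  ⟦ (f *P g) *P h ⟧ φ
    ≡⟨ ⟦⟧-* (f *P g) h φ ⟩
  ⟦ f *P g ⟧ (λ μ → ⟦ h ⟧ (λ η → φ (μ ⊕ η)))
    ≡⟨ ⟦⟧-* f g _ ⟩
  ⟦ f ⟧ (λ β → ⟦ g ⟧ (λ γ → ⟦ h ⟧ (λ η → φ ((β ⊕ γ) ⊕ η))))
    ≡⟨ ⟦⟧-cong f (λ β → ⟦⟧-cong g (λ γ → ⟦⟧-cong h (λ η → cong φ (⊕-assoc β γ η)))) ⟩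
  ⟦ f ⟧ (λ β → ⟦ g ⟧ (λ γ → ⟦ h ⟧ (λ η → φ (β ⊕ (γ ⊕ η)))))
    ≡⟨ ⟦⟧-cong f (λ β → sym (⟦⟧-* g h _)) ⟩
  ⟦ f ⟧ (λ β → ⟦ g *P h ⟧ (λ μ → φ (β ⊕ μ)))
    ≡⟨ sym (⟦⟧-* f (g *P h) φ) ⟩
  ⟦ f *P (g *P h) ⟧ φ ∎

*-interchange : ∀ {n} (a b c d : Poly n) → (a *P b) *P (c *P d) ≐ (a *P c) *P (b *P d)
*-interchange a b c d =
  ≐-trans (*-assoc a b (c *P d))
  (≐-trans (*-cong (≐-refl {f = a}) (≐-sym (*-assoc b c d)))
  (≐-trans (*-cong (≐-refl {f = a}) (*-cong (*-comm b c) (≐-refl {f = d})))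
  (≐-trans (*-cong (≐-refl {f = a}) (*-assoc c b d))
           (≐-sym (*-assoc a c (b *P d))))))

powP-+ : ∀ {n} (f : Poly n) k l → powP f (k ℕ.+ l) ≐ powP f k *P powP f l
powP-+ f zero l = ≐-sym (*-identityˡ _)
powP-+ f (suc k) l = ≐-trans (*-cong (≐-refl {f = f}) (powP-+ f k l)) (≐-sym (*-assoc f _ _))

monoSubst-⊕ : ∀ {n m} (β γ : Monomial n) (B : Fin n → Poly m) →
  monoSubst (β ⊕ γ) B ≐ monoSubst β B *P monoSubst γ B
monoSubst-⊕ [] [] B = ≐-sym (*-identityˡ 1P)
monoSubst-⊕ (k ∷ β) (l ∷ γ) B =
  ≐-trans (*-cong (powP-+ (B zero) k l) (monoSubst-⊕ β γ (λ j → B (suc j))))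
          (*-interchange (powP (B zero) k) (powP (B zero) l)
                         (monoSubst β (λ j → B (suc j))) (monoSubst γ (λ j → B (suc j))))

monoSubst-0ᵐ : ∀ {n m} (B : Fin n → Poly m) → monoSubst (0ᵐ n) B ≐ 1P
monoSubst-0ᵐ {zero} B = ≐-refl
monoSubst-0ᵐ {suc n} B = ≐-trans (*-identityˡ _) (monoSubst-0ᵐ (λ j → B (suc j)))

substP-* : ∀ {n m} (f g : Poly n) (C : Fin n → Poly m) →
  substP (f *P g) C ≐ substP f C *P substP g C
substP-* f g C = pairs-equally λ φ → begin
  ⟦ substP (f *P g) C ⟧ φ
    ≡⟨ ⟦⟧-substP (f *P g) C φ ⟩
  ⟦ f *P g ⟧ (λ μ → ⟦ monoSubst μ C ⟧ φ)
    ≡⟨ ⟦⟧-* f g _ ⟩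
  ⟦ f ⟧ (λ β → ⟦ g ⟧ (λ γ → ⟦ monoSubst (β ⊕ γ) C ⟧ φ))
    ≡⟨ ⟦⟧-cong f (λ β → ⟦⟧-cong g (λ γ →
         trans (pairing (monoSubst-⊕ β γ C) φ) (⟦⟧-* (monoSubst β C) (monoSubst γ C) φ))) ⟩
  ⟦ f ⟧ (λ β → ⟦ g ⟧ (λ γ → ⟦ monoSubst β C ⟧ (λ x → ⟦ monoSubst γ C ⟧ (λ y → φ (x ⊕ y)))))
    ≡⟨ ⟦⟧-cong f (λ β → sym (⟦⟧-swap (monoSubst β C) g _)) ⟩
  ⟦ f ⟧ (λ β → ⟦ monoSubst β C ⟧ (λ x → ⟦ g ⟧ (λ γ → ⟦ monoSubst γ C ⟧ (λ y → φ (x ⊕ y)))))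
    ≡⟨ ⟦⟧-cong f (λ β → ⟦⟧-cong (monoSubst β C) (λ x → sym (⟦⟧-substP g C _))) ⟩
  ⟦ f ⟧ (λ β → ⟦ monoSubst β C ⟧ (λ x → ⟦ substP g C ⟧ (λ y → φ (x ⊕ y))))
    ≡⟨ sym (⟦⟧-substP f C _) ⟩
  ⟦ substP f C ⟧ (λ x → ⟦ substP g C ⟧ (λ y → φ (x ⊕ y)))
    ≡⟨ sym (⟦⟧-* (substP f C) (substP g C) φ) ⟩
  ⟦ substP f C *P substP g C ⟧ φ ∎

substP-1P : ∀ {n m} (C : Fin n → Poly m) → substP 1P C ≐ 1P
substP-1P C = pairs-equally λ φ →
  trans (⟦⟧-substP 1P C φ) (trans (⟦⟧-1P (λ β → ⟦ monoSubst β C ⟧ φ)) (pairing (monoSubst-0ᵐ C) φ))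

substP-powP : ∀ {n m} (f : Poly n) k (C : Fin n → Poly m) →
  substP (powP f k) C ≐ powP (substP f C) k
substP-powP f zero C = substP-1P C
substP-powP f (suc k) C =
  ≐-trans (substP-* f (powP f k) C) (*-cong (≐-refl {f = substP f C}) (substP-powP f k C))

substP-monoSubst : ∀ {n m l} (β : Monomial n) (B : Fin n → Poly m) (C : Fin m → Poly l) →
  substP (monoSubst β B) C ≐ monoSubst β (λ j → substP (B j) C)
substP-monoSubst [] B C = substP-1P C
substP-monoSubst (k ∷ β) B C =
  ≐-trans (substP-* (powP (B zero) k) (monoSubst β (λ j → B (suc j))) C)
          (*-cong (substP-powP (B zero) k C) (substP-monoSubst β (λ j → B (suc j)) C))

substP-assoc : ∀ {n m l} (f : Poly n) (B : Fin n → Poly m) (C : Fin m → Poly l) →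
  substP (substP f B) C ≐ substP f (λ j → substP (B j) C)
substP-assoc f B C = pairs-equally λ φ → begin
  ⟦ substP (substP f B) C ⟧ φ
    ≡⟨ ⟦⟧-substP (substP f B) C φ ⟩
  ⟦ substP f B ⟧ (λ μ → ⟦ monoSubst μ C ⟧ φ)
    ≡⟨ ⟦⟧-substP f B _ ⟩
  ⟦ f ⟧ (λ β → ⟦ monoSubst β B ⟧ (λ μ → ⟦ monoSubst μ C ⟧ φ))
    ≡⟨ ⟦⟧-cong f (λ β → trans (sym (⟦⟧-substP (monoSubst β B) C φ))
                               (pairing (substP-monoSubst β B C) φ)) ⟩
  ⟦ f ⟧ (λ β → ⟦ monoSubst β (λ j → substP (B j) C) ⟧ φ)
    ≡⟨ sym (⟦⟧-substP f _ φ) ⟩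
  ⟦ substP f (λ j → substP (B j) C) ⟧ φ ∎

unit : ∀ {n} → Fin n → Monomial n
unit i = tabulate (λ j → if does (i Data.Fin.≟ j) then 1 else 0)

-- unit zero has the tail tabulate (λ _ → 0), which is the zero exponent.
tabulate-zero : ∀ n → tabulate {n = n} (λ _ → 0) ≡ 0ᵐ n
tabulate-zero zero = refl
tabulate-zero (suc n) = cong (0 ∷_) (tabulate-zero n)

monoSubst-unit : ∀ {n m} (i : Fin n) (B : Fin n → Poly m) → monoSubst (unit i) B ≐ B i
monoSubst-unit {suc n} zero B =
  ≐-trans (*-cong (*-identityʳ (B zero)) ones) (*-identityʳ (B zero))
  where ones : monoSubst (tabulate (λ _ → 0)) (λ j → B (suc j)) ≐ 1P
        ones rewrite tabulate-zero n = monoSubst-0ᵐ (λ j → B (suc j))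
monoSubst-unit {suc n} (suc i) B = ≐-trans (*-identityˡ _) (monoSubst-unit i (λ j → B (suc j)))

substP-varP : ∀ {n m} (i : Fin n) (B : Fin n → Poly m) → substP (varP i) B ≐ B i
substP-varP i B = pairs-equally λ φ →
  trans (⟦⟧-substP (varP i) B φ)
        (trans (ℤP.+-identityʳ _) (trans (ℤP.*-identityˡ _) (pairing (monoSubst-unit i B) φ)))

record IsMonomial {n} (f : Poly n) (γ : Monomial n) : Set where
  constructor pairs-as
  field evaluate : ∀ φ → ⟦ f ⟧ φ ≡ φ γ
open IsMonomial

-- k ·ᵐ γ is the exponent of (X^γ)^k, and substᵐ β ε that of ∏ⱼ (X^{εⱼ})^{βⱼ}.
infixr 7 _·ᵐ_
_·ᵐ_ : ∀ {n} → ℕ → Monomial n → Monomial n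
k ·ᵐ [] = []
k ·ᵐ (x ∷ γ) = k ℕ.* x ∷ k ·ᵐ γ

substᵐ : ∀ {n m} → Monomial n → (Fin n → Monomial m) → Monomial m
substᵐ {m = m} [] ε = 0ᵐ m
substᵐ (k ∷ β) ε = k ·ᵐ ε zero ⊕ substᵐ β (λ j → ε (suc j))

·ᵐ-zero : ∀ {n} (γ : Monomial n) → 0 ·ᵐ γ ≡ 0ᵐ n
·ᵐ-zero [] = refl
·ᵐ-zero (x ∷ γ) = cong (0 ∷_) (·ᵐ-zero γ)

·ᵐ-suc : ∀ {n} k (γ : Monomial n) → suc k ·ᵐ γ ≡ γ ⊕ k ·ᵐ γ
·ᵐ-suc k [] = refl
·ᵐ-suc k (x ∷ γ) = cong (x ℕ.+ k ℕ.* x ∷_) (·ᵐ-suc k γ)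

·ᵐ-0ᵐ : ∀ n k → k ·ᵐ 0ᵐ n ≡ 0ᵐ n
·ᵐ-0ᵐ zero k = refl
·ᵐ-0ᵐ (suc n) k = cong₂ _∷_ (ℕP.*-zeroʳ k) (·ᵐ-0ᵐ n k)

*-monomial : ∀ {n} {f g : Poly n} {β γ} → IsMonomial f β → IsMonomial g γ →
  IsMonomial (f *P g) (β ⊕ γ)
*-monomial {f = f} {g} f≡Xᵝ g≡Xᵞ = pairs-as λ φ →
  trans (⟦⟧-* f g φ) (trans (⟦⟧-cong f (λ β' → evaluate g≡Xᵞ (λ γ' → φ (β' ⊕ γ')))) (evaluate f≡Xᵝ _))

powP-monomial : ∀ {n} {f : Poly n} {γ} → IsMonomial f γ → ∀ k → IsMonomial (powP f k) (k ·ᵐ γ)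
powP-monomial {γ = γ} f≡Xᵞ zero = pairs-as λ φ → trans (⟦⟧-1P φ) (cong φ (sym (·ᵐ-zero γ)))
powP-monomial {γ = γ} f≡Xᵞ (suc k) = pairs-as λ φ →
  trans (evaluate (*-monomial f≡Xᵞ (powP-monomial f≡Xᵞ k)) φ) (cong φ (sym (·ᵐ-suc k γ)))

monoSubst-monomial : ∀ {n m} (β : Monomial n) (B : Fin n → Poly m) (ε : Fin n → Monomial m) →
  (∀ j → IsMonomial (B j) (ε j)) → IsMonomial (monoSubst β B) (substᵐ β ε)
monoSubst-monomial [] B ε B≡Xᵋ = pairs-as ⟦⟧-1P
monoSubst-monomial (k ∷ β) B ε B≡Xᵋ =
  *-monomial (powP-monomial (B≡Xᵋ zero) k)
             (monoSubst-monomial β (λ j → B (suc j)) (λ j → ε (suc j)) (λ j → B≡Xᵋ (suc j)))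

-- Substituting the variables into X^β gives back X^β; the variables of n+1
-- variables are X_0 and the shifts 0 ∷ unit j of those in n variables.
substᵐ-cons0 : ∀ {n m} (β : Monomial n) (ε : Fin n → Monomial m) →
  substᵐ β (λ j → 0 ∷ ε j) ≡ 0 ∷ substᵐ β ε
substᵐ-cons0 [] ε = refl
substᵐ-cons0 (k ∷ β) ε =
  trans (cong (k ·ᵐ (0 ∷ ε zero) ⊕_) (substᵐ-cons0 β (λ j → ε (suc j))))
        (cong (_∷ substᵐ (k ∷ β) ε) (trans (ℕP.+-identityʳ (k ℕ.* 0)) (ℕP.*-zeroʳ k)))

substᵐ-unit : ∀ {n} (β : Monomial n) → substᵐ β unit ≡ β
substᵐ-unit [] = refl
substᵐ-unit {suc n} (k ∷ β) = begin
  k ·ᵐ unit zero ⊕ substᵐ β (λ j → 0 ∷ unit j)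
    ≡⟨ cong (k ·ᵐ unit zero ⊕_) (trans (substᵐ-cons0 β unit) (cong (0 ∷_) (substᵐ-unit β))) ⟩
  (k ℕ.* 1 ℕ.+ 0) ∷ (k ·ᵐ tabulate (λ _ → 0) ⊕ β)
    ≡⟨ cong₂ _∷_ (trans (ℕP.+-identityʳ _) (ℕP.*-identityʳ k)) zeros⊕β ⟩
  k ∷ β ∎
  where
  zeros⊕β : k ·ᵐ tabulate (λ _ → 0) ⊕ β ≡ β
  zeros⊕β rewrite tabulate-zero n | ·ᵐ-0ᵐ n k = ⊕-identityˡ β

varP-monomial : ∀ {n} (j : Fin n) → IsMonomial (varP j) (unit j)
varP-monomial j = pairs-as λ φ → trans (ℤP.+-identityʳ _) (ℤP.*-identityˡ _)

substP-idMap : ∀ {n} (f : Poly n) → substP f idMap ≐ f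
substP-idMap f = pairs-equally λ φ →
  trans (⟦⟧-substP f idMap φ)
        (⟦⟧-cong f (λ β → trans (evaluate (monoSubst-monomial β idMap unit varP-monomial) φ)
                                (cong φ (substᵐ-unit β))))

δ : ∀ {n} → Monomial n → Monomial n → ℤ
δ α β = if does (≡-dec ℕ._≟_ β α) then + 1 else + 0

coeff-⟦⟧ : ∀ {n} (f : Poly n) α → coeff f α ≡ ⟦ f ⟧ (δ α)
coeff-⟦⟧ [] α = refl
coeff-⟦⟧ ((c , β) ∷ f) α with does (≡-dec ℕ._≟_ β α)
... | true = cong₂ _+_ (sym (ℤP.*-identityʳ c)) (coeff-⟦⟧ f α)
... | false = trans (coeff-⟦⟧ f α) (sym (trans (cong (_+ ⟦ f ⟧ (δ α)) (ℤP.*-zeroʳ c)) (ℤP.+-identityˡ _)))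

coeff--P : ∀ {n} (f g : Poly n) α → coeff (f -P g) α ≡ coeff f α - coeff g α
coeff--P f g α = begin
  coeff (f -P g) α                  ≡⟨ coeff-⟦⟧ (f -P g) α ⟩
  ⟦ f -P g ⟧ (δ α)                  ≡⟨ ⟦⟧--P f g (δ α) ⟩
  ⟦ f ⟧ (δ α) - ⟦ g ⟧ (δ α)         ≡⟨ sym (cong₂ _-_ (coeff-⟦⟧ f α) (coeff-⟦⟧ g α)) ⟩
  coeff f α - coeff g α             ∎

-- dropMonomial β h deletes the terms of h with monomial β.  Splitting off all the
-- β-terms at once is how coefficientwise information is turned into pairings.
dropMonomial : ∀ {n} → Monomial n → Poly n → Poly n
dropMonomial β [] = []
dropMonomial β ((c , γ) ∷ h) with ≡-dec ℕ._≟_ γ β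
... | yes _ = dropMonomial β h
... | no _ = (c , γ) ∷ dropMonomial β h

⟦⟧-dropMonomial : ∀ {n} (β : Monomial n) h φ →
  ⟦ h ⟧ φ ≡ coeff h β * φ β + ⟦ dropMonomial β h ⟧ φ
⟦⟧-dropMonomial β [] φ = sym (trans (ℤP.+-identityʳ _) (ℤP.*-zeroˡ (φ β)))
⟦⟧-dropMonomial β ((c , γ) ∷ h) φ with ≡-dec ℕ._≟_ γ β
... | yes refl =
  trans (cong (λ z → c * φ γ + z) (⟦⟧-dropMonomial β h φ))
        (identity c (coeff h β) (φ β) (⟦ dropMonomial β h ⟧ φ))
  where identity : ∀ c d x u → c * x + (d * x + u) ≡ (c + d) * x + u
        identity = solve-∀
... | no _ =
  trans (cong (λ z → c * φ γ + z) (⟦⟧-dropMonomial β h φ))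
        (identity c (coeff h β) (φ γ) (φ β) (⟦ dropMonomial β h ⟧ φ))
  where identity : ∀ c d y x u → c * y + (d * x + u) ≡ d * x + (c * y + u)
        identity = solve-∀

coeff-dropMonomial-same : ∀ {n} (β : Monomial n) h → coeff (dropMonomial β h) β ≡ + 0
coeff-dropMonomial-same β [] = refl
coeff-dropMonomial-same β ((c , γ) ∷ h) with ≡-dec ℕ._≟_ γ β
... | yes _ = coeff-dropMonomial-same β h
... | no γ≢β with ≡-dec ℕ._≟_ γ β
...   | yes γ≡β = ⊥-elim (γ≢β γ≡β)
...   | no _ = coeff-dropMonomial-same β h

coeff-dropMonomial-other : ∀ {n} (β α : Monomial n) h → ¬ β ≡ α →
  coeff (dropMonomial β h) α ≡ coeff h α
coeff-dropMonomial-other β α [] β≢α = refl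
coeff-dropMonomial-other β α ((c , γ) ∷ h) β≢α with ≡-dec ℕ._≟_ γ β
coeff-dropMonomial-other β α ((c , γ) ∷ h) β≢α | yes refl with ≡-dec ℕ._≟_ γ α
... | yes refl = ⊥-elim (β≢α refl)
... | no _ = coeff-dropMonomial-other β α h β≢α
coeff-dropMonomial-other β α ((c , γ) ∷ h) β≢α | no _ with does (≡-dec ℕ._≟_ γ α)
... | true = cong (λ z → c + z) (coeff-dropMonomial-other β α h β≢α)
... | false = coeff-dropMonomial-other β α h β≢α

length-dropMonomial : ∀ {n} (β : Monomial n) h → length (dropMonomial β h) ℕ.≤ length h
length-dropMonomial β [] = ℕ.z≤n
length-dropMonomial β ((c , γ) ∷ h) with ≡-dec ℕ._≟_ γ β
... | yes _ = ℕP.m≤n⇒m≤1+n (length-dropMonomial β h)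
... | no _ = ℕ.s≤s (length-dropMonomial β h)

length-dropMonomial-head : ∀ {n} c (β : Monomial n) h →
  length (dropMonomial β ((c , β) ∷ h)) ℕ.≤ length h
length-dropMonomial-head c β h with ≡-dec ℕ._≟_ β β
... | yes _ = length-dropMonomial β h
... | no β≢β = ⊥-elim (β≢β refl)

infix 4 _≐[_]_
record _≐[_]_ {n} (f : Poly n) (p : ℕ) (g : Poly n) : Set where
  constructor pairs-congruently
  field pairingₚ : ∀ φ → ⟦ f ⟧ φ ≡ ⟦ g ⟧ φ [mod p ]
open _≐[_]_

module _ {p : ℕ} where

  ≐⇒≐[] : ∀ {n} {f g : Poly n} → f ≐ g → f ≐[ p ] g
  ≐⇒≐[] f≐g = pairs-congruently λ φ → ≡⇒mod (pairing f≐g φ)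

  ≐[]-sym : ∀ {n} {f g : Poly n} → f ≐[ p ] g → g ≐[ p ] f
  ≐[]-sym f≐g = pairs-congruently λ φ → mod-sym (pairingₚ f≐g φ)

  ≐[]-trans : ∀ {n} {f g h : Poly n} → f ≐[ p ] g → g ≐[ p ] h → f ≐[ p ] h
  ≐[]-trans f≐g g≐h = pairs-congruently λ φ → mod-trans (pairingₚ f≐g φ) (pairingₚ g≐h φ)

  ⟦⟧-congₚ : ∀ {n} (f : Poly n) {φ ψ} → (∀ β → φ β ≡ ψ β [mod p ]) → ⟦ f ⟧ φ ≡ ⟦ f ⟧ ψ [mod p ]
  ⟦⟧-congₚ [] φ≡ψ = ≡⇒mod refl
  ⟦⟧-congₚ ((c , β) ∷ f) φ≡ψ =
    +-cong-mod (*-cong-mod (≡⇒mod {a = c} refl) (φ≡ψ β)) (⟦⟧-congₚ f φ≡ψ)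

  *-congₚ : ∀ {n} {f f' g g' : Poly n} → f ≐[ p ] f' → g ≐[ p ] g' → f *P g ≐[ p ] f' *P g'
  *-congₚ {f = f} {f'} {g} {g'} f≡f' g≡g' = pairs-congruently λ φ →
    mod-trans (≡⇒mod (⟦⟧-* f g φ))
    (mod-trans (⟦⟧-congₚ f (λ β → pairingₚ g≡g' _))
    (mod-trans (pairingₚ f≡f' _)
                (≡⇒mod (sym (⟦⟧-* f' g' φ)))))

  powP-congₚ : ∀ {n} {f f' : Poly n} k → f ≐[ p ] f' → powP f k ≐[ p ] powP f' k
  powP-congₚ zero f≡f' = ≐⇒≐[] ≐-refl
  powP-congₚ (suc k) f≡f' = *-congₚ f≡f' (powP-congₚ k f≡f')

  monoSubst-congₚ : ∀ {n m} (β : Monomial n) {B B' : Fin n → Poly m} →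
    (∀ j → B j ≐[ p ] B' j) → monoSubst β B ≐[ p ] monoSubst β B'
  monoSubst-congₚ [] B≡B' = ≐⇒≐[] ≐-refl
  monoSubst-congₚ (k ∷ β) B≡B' =
    *-congₚ (powP-congₚ k (B≡B' zero)) (monoSubst-congₚ β (λ j → B≡B' (suc j)))

  substP-congˡₚ : ∀ {n m} {f f' : Poly n} (C : Fin n → Poly m) →
    f ≐[ p ] f' → substP f C ≐[ p ] substP f' C
  substP-congˡₚ {f = f} {f'} C f≡f' = pairs-congruently λ φ →
    mod-trans (≡⇒mod (⟦⟧-substP f C φ))
    (mod-trans (pairingₚ f≡f' _)
                (≡⇒mod (sym (⟦⟧-substP f' C φ))))

  substP-congʳₚ : ∀ {n m} (f : Poly n) {C C' : Fin n → Poly m} →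
    (∀ j → C j ≐[ p ] C' j) → substP f C ≐[ p ] substP f C'
  substP-congʳₚ f {C} {C'} C≡C' = pairs-congruently λ φ →
    mod-trans (≡⇒mod (⟦⟧-substP f C φ))
    (mod-trans (⟦⟧-congₚ f (λ β → pairingₚ (monoSubst-congₚ β C≡C') φ))
                (≡⇒mod (sym (⟦⟧-substP f C' φ))))

  -- A polynomial whose coefficients all vanish mod p pairs to 0 mod p.  Induction
  -- on a bound k for the number of terms: split off all terms of the leading
  -- monomial β, whose total coefficient vanishes mod p, and recurse on the rest.
  ⟦⟧-vanishing : ∀ {n} k (h : Poly n) → length h ℕ.≤ k →
    (∀ α → coeff h α ≡ + 0 [mod p ]) → ∀ φ → ⟦ h ⟧ φ ≡ + 0 [mod p ]
  ⟦⟧-vanishing k [] _ _ φ = ≡⇒mod refl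
  ⟦⟧-vanishing (suc k) ((c , β) ∷ h) (ℕ.s≤s |h|≤k) h≡0 φ =
    mod-trans (≡⇒mod (⟦⟧-dropMonomial β ((c , β) ∷ h) φ))
    (mod-trans (+-cong-mod (*-cong-mod (h≡0 β) (≡⇒mod refl)) rest-vanishes)
               (≡⇒mod (trans (ℤP.+-identityʳ _) (ℤP.*-zeroˡ (φ β)))))
    where
    rest : Poly _
    rest = dropMonomial β ((c , β) ∷ h)

    rest≡0 : ∀ α → coeff rest α ≡ + 0 [mod p ]
    rest≡0 α with ≡-dec ℕ._≟_ β α
    ... | yes refl = ≡⇒mod (coeff-dropMonomial-same β ((c , β) ∷ h))
    ... | no β≢α = mod-trans (≡⇒mod (coeff-dropMonomial-other β α ((c , β) ∷ h) β≢α)) (h≡0 α)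

    rest-vanishes : ⟦ rest ⟧ φ ≡ + 0 [mod p ]
    rest-vanishes =
      ⟦⟧-vanishing k rest (ℕP.≤-trans (length-dropMonomial-head c β h) |h|≤k) rest≡0 φ

  coeff-mod : ∀ {n} (f g : Poly n) → f ≈[ p ] g → ∀ α → coeff f α ≡ coeff g α [mod p ]
  coeff-mod f g f≈g α = from-≡ℤ[] {coeff f α} {coeff g α} (f≈g α)

  ≈[]⇒≐[] : ∀ {n} {f g : Poly n} → f ≈[ p ] g → f ≐[ p ] g
  ≈[]⇒≐[] {f = f} {g} f≈g = pairs-congruently λ φ → difference⇒mod (mod-trans
    (≡⇒mod (sym (⟦⟧--P f g φ)))
    (⟦⟧-vanishing (length (f -P g)) (f -P g) ℕP.≤-refl difference≡0 φ))
    where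
    difference≡0 : ∀ α → coeff (f -P g) α ≡ + 0 [mod p ]
    difference≡0 α = mod-trans (≡⇒mod (coeff--P f g α)) (mod⇒difference (coeff-mod f g f≈g α))

  ≐[]⇒≈[] : ∀ {n} {f g : Poly n} → f ≐[ p ] g → f ≈[ p ] g
  ≐[]⇒≈[] {f = f} {g} f≡g α = to-≡ℤ[] (mod-trans (≡⇒mod (coeff-⟦⟧ f α))
    (mod-trans (pairingₚ f≡g (δ α)) (≡⇒mod (sym (coeff-⟦⟧ g α)))))

  ≈ℤ⇒≈[] : ∀ {n} {f g : Poly n} → f ≈ℤ g → f ≈[ p ] g
  ≈ℤ⇒≈[] f≈g α = to-≡ℤ[] (≡⇒mod (f≈g α))

  -P-congʳ : ∀ {n} (f : Poly n) {g g' : Poly n} → g ≈[ p ] g' → (f -P g) ≈[ p ] (f -P g')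
  -P-congʳ f {g} {g'} g≈g' α = to-≡ℤ[] (mod-trans (≡⇒mod (coeff--P f g α))
    (mod-trans (+-cong-mod (≡⇒mod {a = coeff f α} refl) (neg-cong-mod (coeff-mod g g' g≈g' α)))
               (≡⇒mod (sym (coeff--P f g' α)))))

  -- Inverses are unique over 𝔽_p: if G is a right inverse and U a left inverse
  -- of F modulo p, then U = U∘(F∘G) = (U∘F)∘G = G modulo p.
  inverses-agree : ∀ {n} (F G U : PolyMap n) →
    (∀ i → (F ∘P G) i ≈[ p ] idMap i) → (∀ i → (U ∘P F) i ≈[ p ] idMap i) →
    ∀ i → U i ≈[ p ] G i
  inverses-agree F G U FG≈id UF≈id i = ≐[]⇒≈[]
    (≐[]-trans (≐⇒≐[] (≐-sym (substP-idMap (U i))))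
    (≐[]-trans (substP-congʳₚ (U i) (λ j → ≐[]-sym (≈[]⇒≐[] {f = (F ∘P G) j} {idMap j} (FG≈id j))))
    (≐[]-trans (≐⇒≐[] (≐-sym (substP-assoc (U i) F G)))
    (≐[]-trans (substP-congˡₚ G (≈[]⇒≐[] {f = (U ∘P F) i} {idMap i} (UF≈id i)))
               (≐⇒≐[] (substP-varP i G))))))

-- Reduction mod p is the identity on representatives,
-- so V_l is P_l and W_m − R_m = G − U.
lemma3p2 : (n : ℕ) (F H G U : PolyMap n) (Ds ds : Fin n → ℕ) (D d p : ℕ) →
    (∀ i → F i ≈ℤ (idMap i +P H i)) →
    (∀ i → HasDegree (H i) (Ds i)) →
    (∀ i → HasLowerDegree (H i) (ds i)) →
    (∀ i → ds i ≥ 2) →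
    IsMin ds d → IsMax Ds D →
    IsInverseℤ F G →
    Prime p →
    IsInverse[ p ] (reduceMap p F) U →
    ∀ i →
      (U i ≈[ p ] reduce p (G i)) ×
      (∀ (m : ℕ) → m ≥ 1 →
        (+ (D ^ (n ∸ 1)) - + (ds i)) < (+ m - + 1) * (+ d - + 1) →
        (altSum (iterDiff (reduceMap p F)) m i -P U i)
          ≈[ p ] reduce p (altSum (iterDiff F) m i -P G i))
lemma3p2 n F H G U Ds ds D d p _ _ _ _ _ _ (FG≈id , _) _ (_ , UF≈id) i =
  U≈G , λ m _ _ → -P-congʳ (altSum (iterDiff F) m i) U≈G
  where
  U≈G : U i ≈[ p ] G i
  U≈G = inverses-agree F G U (λ j → ≈ℤ⇒≈[] {f = (F ∘P G) j} {idMap j} (FG≈id j)) UF≈id i
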